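{- Let $G$ be a graph with ${\rm ivs_{\chi}}(G)>{\rm vs_{\chi}}(G)$ and $\chi(G)\ge\frac{\Delta(G)}{2}+1$. Then $|V(G)|\ge 9$, ${\rm ivs_{\chi}}(G)\ge 3$, ${\rm vs_{\chi}}(G)\ge 2$ and $\chi(G)\ge 3$. Moreover, if $|V(G)|=9$, then ${\rm ivs_{\chi}}(G)=3$, ${\rm vs_{\chi}}(G)=2$ and $\chi(G)=3$.
   Context: All graphs are finite and simple. $\chi(G)$ is the chromatic number and $\Delta(G)$ the maximum degree of $G$. ${\rm vs_{\chi}}(G)$ is the minimum size of a set $S\subseteq V(G)$ such that $\chi(G-S)=\chi(G)-1$; ${\rm ivs_{\chi}}(G)$ is the minimum size of an independent set $S\subseteq V(G)$ such that $\chi(G-S)=\chi(G)-1$. -}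

module Defs where

open import Data.Nat using (ℕ; zero; suc; _≤_; _⊔_)
open import Data.Bool using (Bool; true; false; T; if_then_else_)
open import Data.Fin using (Fin)
open import Data.Fin.Subset using (Subset; _∈_; _∉_; ∣_∣)
open import Data.List using (List; map; foldr; allFin)
open import Data.Nat.ListAction using (sum)
open import Data.Product using (Σ; _×_; ∃)
open import Relation.Binary.PropositionalEquality using (_≡_; _≢_)
open import Relation.Nullary using (¬_)

record Graph (n : ℕ) : Set where
  field
    adj      : Fin n → Fin n → Bool
    sym      : ∀ u v → adj u v ≡ adj v u
    loopless : ∀ v → adj v v ≡ false
open Graph public

Adj : ∀ {n} → Graph n → Fin n → Fin n → Set
Adj G u v = T (adj G u v)

degree : ∀ {n} → Graph n → Fin n → ℕ
degree {n} G v = sum (map (λ u → if adj G v u then 1 else 0) (allFin n))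

Δ : ∀ {n} → Graph n → ℕ
Δ {n} G = foldr _⊔_ 0 (map (degree G) (allFin n))

-- A proper k-colouring of the induced subgraph G - S
-- (colours only the vertices outside S).
Colouring : ∀ {n} → Graph n → Subset n → ℕ → Set
Colouring {n} G S k =
  Σ ((v : Fin n) → v ∉ S → Fin k) λ c →
    ∀ u v (u∉S : u ∉ S) (v∉S : v ∉ S) → Adj G u v → c u u∉S ≢ c v v∉S

Colourable : ∀ {n} → Graph n → Subset n → ℕ → Set
Colourable G S k = Colouring G S k

IsMin : (ℕ → Set) → ℕ → Set
IsMin P m = P m × (∀ m′ → P m′ → m ≤ m′)

IsChiMinus : ∀ {n} → Graph n → Subset n → ℕ → Set
IsChiMinus G S k = IsMin (Colourable G S) k

emptySet : ∀ {n} → Subset n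
emptySet {n} = Data.Fin.Subset.⊥

IsChi : ∀ {n} → Graph n → ℕ → Set
IsChi G k = IsChiMinus G emptySet k

Reducing : ∀ {n} → Graph n → Subset n → Set
Reducing G S = ∃ λ j → ∃ λ k → IsChiMinus G S j × IsChi G k × suc j ≡ k

Independent : ∀ {n} → Graph n → Subset n → Set
Independent G S = ∀ u v → u ∈ S → v ∈ S → ¬ Adj G u v

IsVs : ∀ {n} → Graph n → ℕ → Set
IsVs {n} G = IsMin (λ m → Σ (Subset n) λ S → Reducing G S × ∣ S ∣ ≡ m)

IsIvs : ∀ {n} → Graph n → ℕ → Set
IsIvs {n} G = IsMin (λ m → Σ (Subset n) λ S → Independent G S × Reducing G S × ∣ S ∣ ≡ m)

{-# OPTIONS --safe #-}
-- Colour classes of an optimal colouring are independent sets whose removal lowers χ, so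
-- χ · ivs ≤ n, and everything follows from χ ≥ 3 and vs ≥ 2. Both are forced by vs < ivs:
-- sets of at most one vertex are independent, and so is every set when χ = 1. When χ = 2 the
-- degree bound gives Δ ≤ 2, so G is a union of paths and even cycles. A set S with
-- χ(G - S) = 1 is a vertex cover, and in such a graph some proper 2-colouring has a colour
-- class no larger than any vertex cover (delete a leaf with its neighbour and recurse; without
-- leaves, count edge endpoints). That class is an independent set of size ≤ vs lowering χ.
module Submission where

open import Defs hiding (sym)
open import Data.Nat using (ℕ; zero; suc; z≤n; s≤s; _≤_; _<_; _+_; _*_; _⊔_; _≤ᵇ_; _≟_)
open import Data.Nat.Properties
open import Data.Nat.Induction using (<-wellFounded)
open import Data.Nat.ListAction using () renaming (sum to listSum)
open import Algebra.Properties.Semiring.Sum +-*-semiring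
  using (sum; sum-remove; sum-cong-≗; sum-replicate-zero; ∑-distrib-+; ∑-comm; *-distribˡ-sum; *-distribʳ-sum)
open import Data.Bool using (Bool; true; false; T; not; _∧_; if_then_else_)
open import Data.Bool.Properties using (T-≡; T-∧; ∧-comm; ∧-zeroʳ; ∧-identityʳ)
open import Data.Fin using (Fin; zero; suc; punchIn; punchOut) renaming (_≟_ to _≟ᶠ_)
open import Data.Fin.Properties
  using (2↔Bool; punchIn-punchOut; punchInᵢ≢i; punchOut-injective; any?) renaming (suc-injective to sucᶠ-injective)
open import Data.Fin.Subset using (Subset; _∈_; _∉_; ∣_∣; ⊤; _⊆_)
open import Data.Fin.Subset.Properties using (_∈?_; ∈⊤; ∉⊥; ∣⊤∣≡n; ∣p∣≤n; ∣p∣≡n⇒p≡⊤; p⊆q⇒∣p∣≤∣q∣)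
open import Data.Vec using ([]; _∷_; lookup; tabulate)
open import Data.Vec.Properties using ([]=⇒lookup; lookup⇒[]=; lookup∘tabulate)
open import Data.Vec.Functional using (updateAt)
open import Data.Vec.Functional.Properties using (updateAt-updates; updateAt-minimal)
import Data.List as List
open import Data.List.Properties using (map-tabulate; foldr-preservesᵒ)
open import Data.List.Membership.Propositional.Properties using (∈-map⁺; ∈-allFin)
import Data.List.Relation.Unary.Any as Any
open import Data.Product using (_×_; ∃-syntax; _,_; proj₁; proj₂)
open import Data.Sum using (_⊎_; inj₁; inj₂)
open import Function using (_∘_; const; Equivalence; Inverse; Injection)
open import Function.Properties.Inverse using (Inverse⇒Injection)
open import Induction.WellFounded using (Acc; acc)
open import Relation.Binary.PropositionalEquality
  using (_≡_; _≢_; refl; sym; trans; cong; cong₂; subst; subst₂; module ≡-Reasoning)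
open import Relation.Nullary using (¬_; yes; no; does; contradiction)
open import Relation.Nullary.Decidable using (dec-true; dec-false; T?; ¬?; _×-dec_)

𝟙 : Bool → ℕ
𝟙 b = if b then 1 else 0

1≤𝟙 : ∀ {b} → T b → 1 ≤ 𝟙 b
1≤𝟙 {true} _ = s≤s z≤n

0<𝟙⇒T : ∀ {b} → 0 < 𝟙 b → T b
0<𝟙⇒T {true} _ = _

𝟙-∧≤ʳ : ∀ a b → 𝟙 (a ∧ b) ≤ 𝟙 b
𝟙-∧≤ʳ true  b = ≤-refl
𝟙-∧≤ʳ false b = z≤n

𝟙+𝟙-not : ∀ b → 𝟙 b + 𝟙 (not b) ≡ 1
𝟙+𝟙-not true  = refl
𝟙+𝟙-not false = refl

b≢not-b : ∀ b → b ≢ not b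
b≢not-b true  ()
b≢not-b false ()

count : ∀ {n} → (Fin n → Bool) → ℕ
count p = sum (λ v → 𝟙 (p v))

sum-mono-≤ : ∀ {n} {f g : Fin n → ℕ} → (∀ i → f i ≤ g i) → sum f ≤ sum g
sum-mono-≤ {zero}  f≤g = z≤n
sum-mono-≤ {suc n} f≤g = +-mono-≤ (f≤g zero) (sum-mono-≤ (f≤g ∘ suc))

sum-mono-< : ∀ {n} {f g : Fin n → ℕ} → (∀ i → f i ≤ g i) → ∀ i → f i < g i → sum f < sum g
sum-mono-< f≤g zero    fi<gi = +-mono-<-≤ fi<gi (sum-mono-≤ (f≤g ∘ suc))
sum-mono-< f≤g (suc i) fi<gi = +-mono-≤-< (f≤g zero) (sum-mono-< (f≤g ∘ suc) i fi<gi)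

sum-const : ∀ n c → sum {n} (λ _ → c) ≡ n * c
sum-const zero    c = refl
sum-const (suc n) c = cong (c +_) (sum-const n c)

sum-positive : ∀ {n} (f : Fin n → ℕ) → 0 < sum f → ∃[ i ] 0 < f i
sum-positive {suc n} f 0<sum with f zero in f0≡
... | suc _ = zero , subst (0 <_) (sym f0≡) (s≤s z≤n)
... | zero  = let i , 0<fi = sum-positive (f ∘ suc) 0<sum in suc i , 0<fi

term≤sum : ∀ {n} (f : Fin n → ℕ) i → f i ≤ sum f
term≤sum {suc n} f i = ≤-trans (m≤m+n (f i) _) (≤-reflexive (sym (sum-remove {i = i} f)))

two-terms≤sum : ∀ {n} (f : Fin n → ℕ) {i j} → i ≢ j → f i + f j ≤ sum f
two-terms≤sum {suc n} f {i} {j} i≢j = begin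
  f i + f j                                    ≡⟨ cong (λ k → f i + f k) (punchIn-punchOut i≢j) ⟨
  f i + f (punchIn i (punchOut i≢j))           ≤⟨ +-monoʳ-≤ (f i) (term≤sum (f ∘ punchIn i) _) ⟩
  f i + sum (f ∘ punchIn i)                    ≡⟨ sum-remove {i = i} f ⟨
  sum f                                        ∎
  where open ≤-Reasoning

three-terms≤sum : ∀ {n} (f : Fin n → ℕ) {i j k} → i ≢ j → i ≢ k → j ≢ k → f i + (f j + f k) ≤ sum f
three-terms≤sum {suc n} f {i} {j} {k} i≢j i≢k j≢k = begin
  f i + (f j + f k)
    ≡⟨ cong₂ (λ a b → f i + (f a + f b)) (punchIn-punchOut i≢j) (punchIn-punchOut i≢k) ⟨
  f i + (f (punchIn i (punchOut i≢j)) + f (punchIn i (punchOut i≢k)))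
    ≤⟨ +-monoʳ-≤ (f i) (two-terms≤sum (f ∘ punchIn i) (j≢k ∘ punchOut-injective i≢j i≢k)) ⟩
  f i + sum (f ∘ punchIn i)
    ≡⟨ sum-remove {i = i} f ⟨
  sum f ∎
  where open ≤-Reasoning

sum-indicator : ∀ {n} (a : Fin n) → sum (λ i → 𝟙 (does (a ≟ᶠ i))) ≡ 1
sum-indicator {suc n} a = begin
  sum (λ i → 𝟙 (does (a ≟ᶠ i)))
    ≡⟨ sum-remove {i = a} (λ i → 𝟙 (does (a ≟ᶠ i))) ⟩
  𝟙 (does (a ≟ᶠ a)) + sum (λ j → 𝟙 (does (a ≟ᶠ punchIn a j)))
    ≡⟨ cong₂ _+_ (cong 𝟙 (dec-true (a ≟ᶠ a) refl))
                 (sum-cong-≗ (λ j → cong 𝟙 (dec-false (a ≟ᶠ _) (punchInᵢ≢i a j ∘ sym)))) ⟩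
  1 + sum {n} (λ _ → 0)
    ≡⟨ cong suc (sum-replicate-zero n) ⟩
  1 ∎
  where open ≡-Reasoning

count-∧< : ∀ {n} (U s : Fin n → Bool) {w} → U w ≡ false → s w ≡ true → count (λ v → U v ∧ s v) < count s
count-∧< U s {w} Uw≡false sw≡true = sum-mono-< (λ v → 𝟙-∧≤ʳ (U v) (s v)) w
  (subst₂ (λ a b → 𝟙 (a ∧ b) < 𝟙 b) (sym Uw≡false) (sym sw≡true) ≤-refl)

count-updateAt : ∀ {n} (p : Fin n → Bool) i b → count (updateAt p i (const b)) ≤ count p + 𝟙 b
count-updateAt {suc n} p i b = begin
  count (updateAt p i (const b))
    ≡⟨ sum-remove {i = i} (𝟙 ∘ updateAt p i (const b)) ⟩
  𝟙 (updateAt p i (const b) i) + sum (𝟙 ∘ updateAt p i (const b) ∘ punchIn i)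
    ≡⟨ cong₂ _+_ (cong 𝟙 (updateAt-updates i p))
                 (sum-cong-≗ (λ j → cong 𝟙 (updateAt-minimal (punchIn i j) i p (punchInᵢ≢i i j)))) ⟩
  𝟙 b + sum (𝟙 ∘ p ∘ punchIn i)
    ≤⟨ +-monoʳ-≤ (𝟙 b) (m≤n+m _ (𝟙 (p i))) ⟩
  𝟙 b + (𝟙 (p i) + sum (𝟙 ∘ p ∘ punchIn i))
    ≡⟨ cong (𝟙 b +_) (sum-remove {i = i} (𝟙 ∘ p)) ⟨
  𝟙 b + count p
    ≡⟨ +-comm (𝟙 b) (count p) ⟩
  count p + 𝟙 b ∎
  where open ≤-Reasoning

Adj-sym : ∀ {n} (G : Graph n) {u v} → Adj G u v → Adj G v u
Adj-sym G {u} {v} = subst T (Graph.sym G u v)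

Adj-irrefl : ∀ {n} (G : Graph n) {u v} → Adj G u v → u ≢ v
Adj-irrefl G {u} u~u refl = subst T (loopless G u) u~u

deg : ∀ {n} → Graph n → Fin n → ℕ
deg G x = count (adj G x)

degreeSum : ∀ {n} → Graph n → ℕ
degreeSum G = sum (deg G)

Adj⇒1≤deg : ∀ {n} (G : Graph n) {u v} → Adj G u v → 1 ≤ deg G u
Adj⇒1≤deg G {u} {v} u~v = ≤-trans (1≤𝟙 u~v) (term≤sum (𝟙 ∘ adj G u) v)

1≤deg⇒neighbour : ∀ {n} (G : Graph n) {x} → 1 ≤ deg G x → ∃[ y ] Adj G x y
1≤deg⇒neighbour G {x} 1≤deg = let y , 0<𝟙 = sum-positive (𝟙 ∘ adj G x) 1≤deg in y , 0<𝟙⇒T 0<𝟙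

deg≤1⇒neighbour-unique : ∀ {n} (G : Graph n) {x u v} → deg G x ≤ 1 → Adj G x u → Adj G x v → u ≡ v
deg≤1⇒neighbour-unique G {x} {u} {v} deg≤1 x~u x~v with u ≟ᶠ v
... | yes u≡v = u≡v
... | no  u≢v = contradiction
  (≤-trans (+-mono-≤ (1≤𝟙 x~u) (1≤𝟙 x~v)) (two-terms≤sum (𝟙 ∘ adj G x) u≢v)) (<⇒≱ (s≤s deg≤1))

deg≤2⇒other-neighbour-unique : ∀ {n} (G : Graph n) {y x u v} → deg G y ≤ 2 →
  Adj G y x → Adj G y u → Adj G y v → u ≢ x → v ≢ x → u ≡ v
deg≤2⇒other-neighbour-unique G {y} {x} {u} {v} deg≤2 y~x y~u y~v u≢x v≢x with u ≟ᶠ v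
... | yes u≡v = u≡v
... | no  u≢v = contradiction
  (≤-trans (+-mono-≤ (1≤𝟙 y~x) (+-mono-≤ (1≤𝟙 y~u) (1≤𝟙 y~v)))
           (three-terms≤sum (𝟙 ∘ adj G y) (u≢x ∘ sym) (v≢x ∘ sym) u≢v))
  (<⇒≱ (s≤s deg≤2))

listSum-tabulate : ∀ {n} (f : Fin n → ℕ) → listSum (List.tabulate f) ≡ sum f
listSum-tabulate {zero}  f = refl
listSum-tabulate {suc n} f = cong (f zero +_) (listSum-tabulate (f ∘ suc))

degree≡deg : ∀ {n} (G : Graph n) x → degree G x ≡ deg G x
degree≡deg G x =
  trans (cong listSum (map-tabulate (λ v → v) (𝟙 ∘ adj G x))) (listSum-tabulate (𝟙 ∘ adj G x))

degree≤Δ : ∀ {n} (G : Graph n) x → degree G x ≤ Δ G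
degree≤Δ {n} G x = foldr-preservesᵒ ≤-⊔ 0 (List.map (degree G) (List.allFin n))
  (inj₂ (Any.map ≤-reflexive (∈-map⁺ (degree G) (∈-allFin x))))
  where
  ≤-⊔ : ∀ a b → degree G x ≤ a ⊎ degree G x ≤ b → degree G x ≤ a ⊔ b
  ≤-⊔ a b (inj₁ ≤a) = ≤-trans ≤a (m≤m⊔n a b)
  ≤-⊔ a b (inj₂ ≤b) = ≤-trans ≤b (m≤n⊔m a b)

deg≤Δ : ∀ {n} (G : Graph n) x → deg G x ≤ Δ G
deg≤Δ G x = subst (_≤ Δ G) (degree≡deg G x) (degree≤Δ G x)

Proper₂ : ∀ {n} → Graph n → (Fin n → Bool) → Set
Proper₂ G d = ∀ u v → Adj G u v → d u ≢ d v

Covers : ∀ {n} → Graph n → (Fin n → Bool) → Set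
Covers G s = ∀ u v → Adj G u v → s u ≡ true ⊎ s v ≡ true

weight : ∀ {n} → Graph n → (Fin n → Bool) → ℕ
weight G p = sum (λ x → deg G x * 𝟙 (p x))

endpoints : ∀ {n} → Graph n → (Fin n → Bool) → ℕ
endpoints G p = sum (λ x → sum (λ v → 𝟙 (adj G x v) * (𝟙 (p x) + 𝟙 (p v))))

endpoints≡2*weight : ∀ {n} (G : Graph n) p → endpoints G p ≡ 2 * weight G p
endpoints≡2*weight {n} G p = begin
  endpoints G p
    ≡⟨ sum-cong-≗ (λ x → trans (sum-cong-≗ (λ v → *-distribˡ-+ (a x v) _ _))
                                (∑-distrib-+ (byTail x) (byHead x))) ⟩
  sum (λ x → sum (byTail x) + sum (byHead x))
    ≡⟨ ∑-distrib-+ (sum ∘ byTail) (sum ∘ byHead) ⟩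
  sum (sum ∘ byTail) + sum (sum ∘ byHead)
    ≡⟨ cong (sum (sum ∘ byTail) +_) (∑-comm (λ x v → a x v * 𝟙 (p v))) ⟩
  sum (sum ∘ byTail) + sum (λ v → sum (λ x → a x v * 𝟙 (p v)))
    ≡⟨ cong (sum (sum ∘ byTail) +_)
            (sum-cong-≗ (λ v → sum-cong-≗ (λ x → cong (λ b → 𝟙 b * 𝟙 (p v)) (Graph.sym G x v)))) ⟩
  sum (sum ∘ byTail) + sum (sum ∘ byTail)
    ≡⟨ cong₂ _+_ byTails≡weight byTails≡weight ⟩
  weight G p + weight G p
    ≡⟨ cong (weight G p +_) (+-identityʳ (weight G p)) ⟨
  2 * weight G p ∎
  where
  open ≡-Reasoning
  a byTail byHead : Fin n → Fin n → ℕ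
  a x v = 𝟙 (adj G x v)
  byTail x v = a x v * 𝟙 (p x)
  byHead x v = a x v * 𝟙 (p v)
  byTails≡weight : sum (sum ∘ byTail) ≡ weight G p
  byTails≡weight = sum-cong-≗ (λ x → sym (*-distribʳ-sum (𝟙 (p x)) (a x)))

𝟙-properEdge : ∀ a p q → (T a → p ≢ q) → 𝟙 a * (𝟙 p + 𝟙 q) ≡ 𝟙 a
𝟙-properEdge false p     q     _    = refl
𝟙-properEdge true  true  true  p≢q = contradiction refl (p≢q _)
𝟙-properEdge true  true  false _    = refl
𝟙-properEdge true  false true  _    = refl
𝟙-properEdge true  false false p≢q = contradiction refl (p≢q _)

𝟙-coveredEdge : ∀ a p q → (T a → p ≡ true ⊎ q ≡ true) → 𝟙 a ≤ 𝟙 a * (𝟙 p + 𝟙 q)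
𝟙-coveredEdge false p     q     _     = z≤n
𝟙-coveredEdge true  true  q     _     = s≤s z≤n
𝟙-coveredEdge true  false true  _     = s≤s z≤n
𝟙-coveredEdge true  false false cover with cover _
... | inj₁ ()
... | inj₂ ()

-- Over ordered adjacent pairs, a colour class contains exactly one endpoint and a cover at least one.
weight-proper≤weight-cover : ∀ {n} (G : Graph n) {d s} → Proper₂ G d → Covers G s → weight G d ≤ weight G s
weight-proper≤weight-cover G {d} {s} d-proper s-covers = *-cancelˡ-≤ 2 (begin
  2 * weight G d  ≡⟨ endpoints≡2*weight G d ⟨
  endpoints G d   ≡⟨ sum-cong-≗ (λ x → sum-cong-≗ (λ v →
                       𝟙-properEdge (adj G x v) (d x) (d v) (d-proper x v))) ⟩
  degreeSum G     ≤⟨ sum-mono-≤ (λ x → sum-mono-≤ (λ v →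
                       𝟙-coveredEdge (adj G x v) (s x) (s v) (s-covers x v))) ⟩
  endpoints G s   ≡⟨ endpoints≡2*weight G s ⟩
  2 * weight G s  ∎)
  where open ≤-Reasoning

weight≤2*count : ∀ {n} (G : Graph n) → (∀ x → deg G x ≤ 2) → ∀ p → weight G p ≤ 2 * count p
weight≤2*count G Δ≤2 p = begin
  weight G p                   ≤⟨ sum-mono-≤ (λ x → *-monoˡ-≤ (𝟙 (p x)) (Δ≤2 x)) ⟩
  sum (λ x → 2 * 𝟙 (p x))      ≡⟨ *-distribˡ-sum 2 (𝟙 ∘ p) ⟨
  2 * count p                  ∎
  where open ≤-Reasoning

2*count≤weight : ∀ {n} (G : Graph n) p → (∀ x → p x ≡ true → 2 ≤ deg G x) → 2 * count p ≤ weight G p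
2*count≤weight G p 2≤deg = begin
  2 * count p                  ≡⟨ *-distribˡ-sum 2 (𝟙 ∘ p) ⟩
  sum (λ x → 2 * 𝟙 (p x))      ≤⟨ sum-mono-≤ pointwise ⟩
  weight G p                   ∎
  where
  open ≤-Reasoning
  pointwise : ∀ x → 2 * 𝟙 (p x) ≤ deg G x * 𝟙 (p x)
  pointwise x with p x in px
  ... | true  = *-monoˡ-≤ 1 (2≤deg x px)
  ... | false = z≤n

leafless-class≤cover : ∀ {n} (G : Graph n) {col s} → Proper₂ G col → (∀ x → deg G x ≤ 2) →
  (∀ x → deg G x ≢ 1) → Covers G s → ∃[ d ] Proper₂ G d × count d ≤ count s
leafless-class≤cover {n} G {col} {s} col-proper Δ≤2 no-leaf s-covers =
  d , d-proper , *-cancelˡ-≤ 2 (begin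
  2 * count d  ≤⟨ 2*count≤weight G d d-deg ⟩
  weight G d   ≤⟨ weight-proper≤weight-cover G d-proper s-covers ⟩
  weight G s   ≤⟨ weight≤2*count G Δ≤2 s ⟩
  2 * count s  ∎)
  where
  open ≤-Reasoning
  -- Isolated vertices are left out of the class, so every vertex in it has degree 2.
  d : Fin n → Bool
  d x = col x ∧ (1 ≤ᵇ deg G x)
  d≡col : ∀ {x} → 1 ≤ deg G x → d x ≡ col x
  d≡col {x} 1≤deg = trans (cong (col x ∧_) (Equivalence.to T-≡ (≤⇒≤ᵇ 1≤deg))) (∧-identityʳ (col x))
  d-proper : Proper₂ G d
  d-proper u v u~v = subst₂ _≢_ (sym (d≡col (Adj⇒1≤deg G u~v)))
                                (sym (d≡col (Adj⇒1≤deg G (Adj-sym G u~v))))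
                                (col-proper u v u~v)
  d-deg : ∀ x → d x ≡ true → 2 ≤ deg G x
  d-deg x dx = ≤∧≢⇒< 1≤deg (λ 1≡deg → no-leaf x (sym 1≡deg))
    where
    1≤deg : 1 ≤ deg G x
    1≤deg = ≤ᵇ⇒≤ 1 (deg G x) (proj₂ (Equivalence.to T-∧ (Equivalence.from T-≡ dx)))

_↾_ : ∀ {n} → Graph n → (Fin n → Bool) → Graph n
G ↾ U = record
  { adj      = λ u v → (U u ∧ U v) ∧ adj G u v
  ; sym      = λ u v → cong₂ _∧_ (∧-comm (U u) (U v)) (Graph.sym G u v)
  ; loopless = λ v → trans (cong ((U v ∧ U v) ∧_) (loopless G v)) (∧-zeroʳ (U v ∧ U v))
  }

↾-Adj⇒Adj : ∀ {n} (G : Graph n) {U u v} → Adj (G ↾ U) u v → Adj G u v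
↾-Adj⇒Adj G u~v = proj₂ (Equivalence.to T-∧ u~v)

Adj⇒↾-Adj : ∀ {n} (G : Graph n) {U u v} → U u ≡ true → U v ≡ true → Adj G u v → Adj (G ↾ U) u v
Adj⇒↾-Adj G Uu Uv u~v = Equivalence.from T-∧
  (Equivalence.from T-∧ (Equivalence.from T-≡ Uu , Equivalence.from T-≡ Uv) , u~v)

Covers-↾ : ∀ {n} (G : Graph n) {U s} → Covers G s → Covers (G ↾ U) (λ v → U v ∧ s v)
Covers-↾ G {U} {s} s-covers u v u~v
  with Equivalence.to T-∧ u~v
... | Uu∧Uv , u~ᴳv with Equivalence.to T-∧ Uu∧Uv | s-covers u v u~ᴳv
...   | Uu , _  | inj₁ su = inj₁ (cong₂ _∧_ (Equivalence.to T-≡ Uu) su)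
...   | _  , Uv | inj₂ sv = inj₂ (cong₂ _∧_ (Equivalence.to T-≡ Uv) sv)

deg-↾≤ : ∀ {n} (G : Graph n) {U} x → deg (G ↾ U) x ≤ deg G x
deg-↾≤ G {U} x = sum-mono-≤ (λ v → 𝟙-∧≤ʳ (U x ∧ U v) (adj G x v))

degreeSum-↾< : ∀ {n} (G : Graph n) {U x y} → Adj G x y → U x ≡ false → degreeSum (G ↾ U) < degreeSum G
degreeSum-↾< G {U} {x} {y} x~y Ux≡false = sum-mono-< (deg-↾≤ G {U}) x
  (sum-mono-< (λ v → 𝟙-∧≤ʳ (U x ∧ U v) (adj G x v)) y
    (subst (λ b → 𝟙 ((b ∧ U y) ∧ adj G x y) < 𝟙 (adj G x y)) (sym Ux≡false) (1≤𝟙 x~y)))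

outside : ∀ {n} → Fin n → Fin n → Fin n → Bool
outside x y v = not (does (v ≟ᶠ x)) ∧ not (does (v ≟ᶠ y))

outside-left : ∀ {n} (x y : Fin n) → outside x y x ≡ false
outside-left x y = cong (λ b → not b ∧ not (does (x ≟ᶠ y))) (dec-true (x ≟ᶠ x) refl)

outside-right : ∀ {n} (x y : Fin n) → outside x y y ≡ false
outside-right x y = trans (cong (λ b → not (does (y ≟ᶠ x)) ∧ not b) (dec-true (y ≟ᶠ y) refl))
                          (∧-zeroʳ (not (does (y ≟ᶠ x))))

outside-other : ∀ {n} {x y v : Fin n} → v ≢ x → v ≢ y → outside x y v ≡ true
outside-other {x = x} {y} {v} v≢x v≢y =
  cong₂ (λ a b → not a ∧ not b) (dec-false (v ≟ᶠ x) v≢x) (dec-false (v ≟ᶠ y) v≢y)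

-- Every cover contains x or y, so deleting both costs the cover a
-- vertex, while the colouring extends by giving x and y opposite colours, y's opposite to the
-- colour of its other neighbour (unique, since deg y ≤ 2), at the cost of one class vertex.
leaf-step : ∀ {n} (G : Graph n) {x y s} → Adj G x y → deg G x ≤ 1 → deg G y ≤ 2 → Covers G s →
  (∃[ d ] Proper₂ (G ↾ outside x y) d × count d ≤ count (λ v → outside x y v ∧ s v)) →
  ∃[ d ] Proper₂ G d × count d ≤ count s
leaf-step {n} G {x} {y} {s} x~y deg-x≤1 deg-y≤2 s-covers (d′ , d′-proper , d′≤) =
  let b , agree = other-neighbours-agree in extend b agree
  where
  other-neighbours-agree : ∃[ b ] ∀ v → Adj G y v → v ≢ x → d′ v ≡ b
  other-neighbours-agree with any? (λ z → T? (adj G y z) ×-dec ¬? (z ≟ᶠ x))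
  ... | yes (z , y~z , z≢x) = d′ z ,
    λ v y~v v≢x → cong d′ (deg≤2⇒other-neighbour-unique G deg-y≤2 (Adj-sym G x~y) y~v y~z v≢x z≢x)
  ... | no  no-other = false , λ v y~v v≢x → contradiction (v , y~v , v≢x) no-other

  x≢y : x ≢ y
  x≢y = Adj-irrefl G x~y

  extend : ∀ b → (∀ v → Adj G y v → v ≢ x → d′ v ≡ b) → ∃[ d ] Proper₂ G d × count d ≤ count s
  extend b agree = d , d-proper , count-d
    where
    d : Fin n → Bool
    d = updateAt (updateAt d′ x (const b)) y (const (not b))

    d-x : d x ≡ b
    d-x = trans (updateAt-minimal x y _ x≢y) (updateAt-updates x d′)

    d-y : d y ≡ not b
    d-y = updateAt-updates y _

    d-other : ∀ {v} → v ≢ x → v ≢ y → d v ≡ d′ v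
    d-other {v} v≢x v≢y = trans (updateAt-minimal v y _ v≢y) (updateAt-minimal v x d′ v≢x)

    at-x : ∀ v → Adj G x v → d x ≢ d v
    at-x v x~v rewrite deg≤1⇒neighbour-unique G deg-x≤1 x~v x~y =
      subst₂ _≢_ (sym d-x) (sym d-y) (b≢not-b b)

    at-y : ∀ v → Adj G y v → d y ≢ d v
    at-y v y~v with v ≟ᶠ x
    ... | yes refl = subst₂ _≢_ (sym d-y) (sym d-x) (b≢not-b b ∘ sym)
    ... | no  v≢x  = subst₂ _≢_ (sym d-y)
                       (sym (trans (d-other v≢x (Adj-irrefl G y~v ∘ sym)) (agree v y~v v≢x)))
                       (b≢not-b b ∘ sym)

    d-proper : Proper₂ G d
    d-proper u v u~v with u ≟ᶠ x | u ≟ᶠ y | v ≟ᶠ x | v ≟ᶠ y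
    ... | yes refl | _        | _        | _        = at-x v u~v
    ... | no  _    | yes refl | _        | _        = at-y v u~v
    ... | no  _    | no  _    | yes refl | _        = at-x u (Adj-sym G u~v) ∘ sym
    ... | no  _    | no  _    | no  _    | yes refl = at-y u (Adj-sym G u~v) ∘ sym
    ... | no  u≢x  | no  u≢y  | no  v≢x  | no  v≢y  =
      subst₂ _≢_ (sym (d-other u≢x u≢y)) (sym (d-other v≢x v≢y))
        (d′-proper u v (Adj⇒↾-Adj G (outside-other u≢x u≢y) (outside-other v≢x v≢y) u~v))

    s-drops : count (λ v → outside x y v ∧ s v) < count s
    s-drops with s-covers x y x~y
    ... | inj₁ sx = count-∧< (outside x y) s (outside-left x y) sx
    ... | inj₂ sy = count-∧< (outside x y) s (outside-right x y) sy

    count-d : count d ≤ count s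
    count-d = begin
      count d                                   ≤⟨ count-updateAt (updateAt d′ x (const b)) y (not b) ⟩
      count (updateAt d′ x (const b)) + 𝟙 (not b) ≤⟨ +-monoˡ-≤ (𝟙 (not b)) (count-updateAt d′ x b) ⟩
      count d′ + 𝟙 b + 𝟙 (not b)               ≡⟨ +-assoc (count d′) (𝟙 b) (𝟙 (not b)) ⟩
      count d′ + (𝟙 b + 𝟙 (not b))             ≡⟨ cong (count d′ +_) (𝟙+𝟙-not b) ⟩
      count d′ + 1                              ≡⟨ +-comm (count d′) 1 ⟩
      suc (count d′)                            ≤⟨ s≤s d′≤ ⟩
      suc (count (λ v → outside x y v ∧ s v))   ≤⟨ s-drops ⟩
      count s                                   ∎
      where open ≤-Reasoning

colour-class≤cover : ∀ {n} (G : Graph n) {col} → Proper₂ G col → (∀ x → deg G x ≤ 2) →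
  ∀ {s} → Covers G s → ∃[ d ] Proper₂ G d × count d ≤ count s
colour-class≤cover {n} G {col} = go G (<-wellFounded (degreeSum G))
  where
  go : ∀ H → Acc _<_ (degreeSum H) → Proper₂ H col → (∀ x → deg H x ≤ 2) →
       ∀ {s} → Covers H s → ∃[ d ] Proper₂ H d × count d ≤ count s
  go H (acc smaller) col-proper Δ≤2 s-covers with any? (λ x → deg H x ≟ 1)
  ... | no  no-leaf = leafless-class≤cover H col-proper Δ≤2 (λ x deg≡1 → no-leaf (x , deg≡1)) s-covers
  ... | yes (x , deg≡1) =
    let y , x~y = 1≤deg⇒neighbour H (≤-reflexive (sym deg≡1))
        U = outside x y
    in leaf-step H x~y (≤-reflexive deg≡1) (Δ≤2 y) s-covers
         (go (H ↾ U) (smaller (degreeSum-↾< H {U} x~y (outside-left x y)))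
             (λ u v u~v → col-proper u v (↾-Adj⇒Adj H {U} u~v))
             (λ v → ≤-trans (deg-↾≤ H {U} v) (Δ≤2 v))
             (Covers-↾ H {U} s-covers))

∣∣≡count-lookup : ∀ {n} (S : Subset n) → ∣ S ∣ ≡ count (lookup S)
∣∣≡count-lookup []          = refl
∣∣≡count-lookup (true ∷ S)  = cong suc (∣∣≡count-lookup S)
∣∣≡count-lookup (false ∷ S) = ∣∣≡count-lookup S

∣tabulate∣≡count : ∀ {n} (p : Fin n → Bool) → ∣ tabulate p ∣ ≡ count p
∣tabulate∣≡count p = trans (∣∣≡count-lookup (tabulate p)) (sum-cong-≗ (cong 𝟙 ∘ lookup∘tabulate p))

∈-tabulate⇒ : ∀ {n} {p : Fin n → Bool} {v} → v ∈ tabulate p → p v ≡ true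
∈-tabulate⇒ {p = p} {v} v∈ = trans (sym (lookup∘tabulate p v)) ([]=⇒lookup v∈)

∉-tabulate⇒ : ∀ {n} {p : Fin n → Bool} {v} → v ∉ tabulate p → p v ≡ false
∉-tabulate⇒ {p = p} {v} v∉ with p v in pv
... | true  = contradiction (lookup⇒[]= v (tabulate p) (trans (lookup∘tabulate p v) pv)) v∉
... | false = refl

lookup≡false⇒∉ : ∀ {n} {S : Subset n} {v} → lookup S v ≡ false → v ∉ S
lookup≡false⇒∉ Sv≡false v∈S = contradiction (trans (sym Sv≡false) ([]=⇒lookup v∈S)) λ ()

IsMin-unique : ∀ {P : ℕ → Set} {a b} → IsMin P a → IsMin P b → a ≡ b
IsMin-unique (Pa , a-min) (Pb , b-min) = ≤-antisym (a-min _ Pb) (b-min _ Pa)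

1-colouring⇒complement-independent : ∀ {n} (G : Graph n) {S} → Colourable G S 1 →
  ∀ u v → u ∉ S → v ∉ S → ¬ Adj G u v
1-colouring⇒complement-independent G (c , c-proper) u v u∉S v∉S u~v
  with c u u∉S | c v v∉S | c-proper u v u∉S v∉S u~v
... | zero | zero | c-differs = c-differs refl

complement-independent⇒1-colouring : ∀ {n} (G : Graph n) {S} →
  (∀ u v → u ∉ S → v ∉ S → ¬ Adj G u v) → Colourable G S 1
complement-independent⇒1-colouring G indep = (λ _ _ → zero) , λ u v u∉S v∉S u~v _ → indep u v u∉S v∉S u~v

1-colouring⇒covers : ∀ {n} (G : Graph n) {S} → Colourable G S 1 → Covers G (lookup S)
1-colouring⇒covers G {S} colouring u v u~v with lookup S u in Su | lookup S v in Sv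
... | true  | _     = inj₁ refl
... | false | true  = inj₂ refl
... | false | false = contradiction u~v
  (1-colouring⇒complement-independent G colouring u v (lookup≡false⇒∉ Su) (lookup≡false⇒∉ Sv))

0-colouring⇒full : ∀ {n} (G : Graph n) {S} → Colourable G S 0 → ⊤ ⊆ S
0-colouring⇒full G {S} (c , _) {v} _ with v ∈? S
... | yes v∈S = v∈S
... | no  v∉S with c v v∉S
...   | ()

full⇒0-colouring : ∀ {n} (G : Graph n) {S} → ⊤ ⊆ S → Colourable G S 0
full⇒0-colouring G ⊤⊆S =
  (λ v v∉S → contradiction (⊤⊆S ∈⊤) v∉S) , λ u _ u∉S _ _ → contradiction (⊤⊆S ∈⊤) u∉S

IsChiMinus-suc⇒∣∣<n : ∀ {n} (G : Graph n) {S j} → IsChiMinus G S (suc j) → ∣ S ∣ < n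
IsChiMinus-suc⇒∣∣<n G {S} (_ , minimal) = ≤∧≢⇒< (∣p∣≤n S) λ ∣S∣≡n →
  <⇒≱ (s≤s z≤n) (minimal 0 (full⇒0-colouring G (subst (_ ∈_) (sym (∣p∣≡n⇒p≡⊤ ∣S∣≡n)))))

reducing⇒χ-minus : ∀ {n} (G : Graph n) {S χ} → IsChi G χ → Reducing G S →
  ∃[ j ] χ ≡ suc j × IsChiMinus G S j
reducing⇒χ-minus G χ-min (j , k , S-min , k-min , suc-j≡k) =
  j , trans (IsMin-unique χ-min k-min) (sym suc-j≡k) , S-min

∣∣≤1⇒independent : ∀ {n} (G : Graph n) {S} → ∣ S ∣ ≤ 1 → Independent G S
∣∣≤1⇒independent G {S} ∣S∣≤1 u v u∈S v∈S u~v = <⇒≱ (s≤s ∣S∣≤1) (begin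
  2                                      ≤⟨ +-mono-≤ (member u∈S) (member v∈S) ⟩
  𝟙 (lookup S u) + 𝟙 (lookup S v)        ≤⟨ two-terms≤sum (𝟙 ∘ lookup S) (Adj-irrefl G u~v) ⟩
  count (lookup S)                       ≡⟨ ∣∣≡count-lookup S ⟨
  ∣ S ∣                                  ∎)
  where
  open ≤-Reasoning
  member : ∀ {w} → w ∈ S → 1 ≤ 𝟙 (lookup S w)
  member w∈S = subst (λ b → 1 ≤ 𝟙 b) (sym ([]=⇒lookup w∈S)) ≤-refl

1-colouring⇒edgeless : ∀ {n} (G : Graph n) → Colourable G emptySet 1 → ∀ S → Independent G S
1-colouring⇒edgeless G colouring S u v _ _ = 1-colouring⇒complement-independent G colouring u v ∉⊥ ∉⊥

2-colouring⇒Proper₂ : ∀ {n} (G : Graph n) → Colourable G emptySet 2 → ∃[ col ] Proper₂ G col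
2-colouring⇒Proper₂ G (c , c-proper) = (λ v → Inverse.to 2↔Bool (c v ∉⊥)) ,
  λ u v u~v → c-proper u v ∉⊥ ∉⊥ u~v ∘ Injection.injective (Inverse⇒Injection 2↔Bool)

proper-class⇒independent-reducing : ∀ {n} (G : Graph n) {d} → IsChi G 2 → Proper₂ G d →
  ∣ tabulate d ∣ < n → Independent G (tabulate d) × Reducing G (tabulate d)
proper-class⇒independent-reducing {n} G {d} χ≡2 d-proper ∣d∣<n =
  independent , 1 , 2 , (complement-independent⇒1-colouring G complement-independent , minimal) , χ≡2 , refl
  where
  independent : Independent G (tabulate d)
  independent u v u∈ v∈ u~v = d-proper u v u~v (trans (∈-tabulate⇒ u∈) (sym (∈-tabulate⇒ v∈)))
  complement-independent : ∀ u v → u ∉ tabulate d → v ∉ tabulate d → ¬ Adj G u v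
  complement-independent u v u∉ v∉ u~v = d-proper u v u~v (trans (∉-tabulate⇒ u∉) (sym (∉-tabulate⇒ v∉)))
  minimal : ∀ m → Colourable G (tabulate d) m → 1 ≤ m
  minimal zero    colouring = contradiction
    (≤-trans (≤-reflexive (sym (∣⊤∣≡n n))) (p⊆q⇒∣p∣≤∣q∣ (0-colouring⇒full G colouring)))
    (<⇒≱ ∣d∣<n)
  minimal (suc m) _ = s≤s z≤n

χ≡2⇒independent-reducing : ∀ {n} (G : Graph n) {S} → IsChi G 2 → (∀ x → deg G x ≤ 2) →
  IsChiMinus G S 1 → ∃[ S′ ] Independent G S′ × Reducing G S′ × ∣ S′ ∣ ≤ ∣ S ∣
χ≡2⇒independent-reducing G {S} χ≡2 Δ≤2 S-min =
  let col , col-proper = 2-colouring⇒Proper₂ G (proj₁ χ≡2)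
      d , d-proper , count-d≤ = colour-class≤cover G col-proper Δ≤2 (1-colouring⇒covers G (proj₁ S-min))
      ∣d∣≤∣S∣ = subst₂ _≤_ (sym (∣tabulate∣≡count d)) (sym (∣∣≡count-lookup S)) count-d≤
      independent , reducing = proper-class⇒independent-reducing G χ≡2 d-proper
                                 (≤-<-trans ∣d∣≤∣S∣ (IsChiMinus-suc⇒∣∣<n G S-min))
  in tabulate d , independent , reducing , ∣d∣≤∣S∣

χ≤2⇒independent-reducing : ∀ {n} (G : Graph n) {χ S} → IsChi G χ → χ ≤ 2 → Δ G + 2 ≤ 2 * χ →
  Reducing G S → ∃[ S′ ] Independent G S′ × Reducing G S′ × ∣ S′ ∣ ≤ ∣ S ∣
χ≤2⇒independent-reducing G {S = S} χ-min χ≤2 Δ+2≤2χ S-reducing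
  with reducing⇒χ-minus G χ-min S-reducing
... | zero , refl , _ = S , 1-colouring⇒edgeless G (proj₁ χ-min) S , S-reducing , ≤-refl
... | suc zero , refl , S-min =
  χ≡2⇒independent-reducing G χ-min (λ x → ≤-trans (deg≤Δ G x) (+-cancelʳ-≤ 2 (Δ G) 2 Δ+2≤2χ)) S-min
... | suc (suc _) , refl , _ = contradiction χ≤2 λ { (s≤s (s≤s ())) }

module ColourClasses {n} (G : Graph n) {k} (χ≡suc-k : IsChi G (suc k)) where

  colour : Fin n → Fin (suc k)
  colour v = proj₁ (proj₁ χ≡suc-k) v ∉⊥

  colour-proper : ∀ u v → Adj G u v → colour u ≢ colour v
  colour-proper u v = proj₂ (proj₁ χ≡suc-k) u v ∉⊥ ∉⊥

  class : Fin (suc k) → Subset n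
  class i = tabulate (λ v → does (colour v ≟ᶠ i))

  ∈-class⇒ : ∀ {i v} → v ∈ class i → colour v ≡ i
  ∈-class⇒ {i} {v} v∈ with colour v ≟ᶠ i | ∈-tabulate⇒ {p = λ w → does (colour w ≟ᶠ i)} v∈
  ... | yes colour≡i | _ = colour≡i

  ∉-class⇒ : ∀ {i v} → v ∉ class i → i ≢ colour v
  ∉-class⇒ {i} {v} v∉ i≡colour =
    contradiction (trans (sym (∉-tabulate⇒ v∉)) (dec-true (colour v ≟ᶠ i) (sym i≡colour))) λ ()

  class-independent : ∀ i → Independent G (class i)
  class-independent i u v u∈ v∈ u~v = colour-proper u v u~v (trans (∈-class⇒ u∈) (sym (∈-class⇒ v∈)))

  class-reducing : ∀ i → Reducing G (class i)
  class-reducing i = k , suc k , (colouring , minimal) , χ≡suc-k , refl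
    where
    colouring : Colourable G (class i) k
    colouring = (λ v v∉ → punchOut (∉-class⇒ v∉)) ,
      λ u v u∉ v∉ u~v → colour-proper u v u~v ∘ punchOut-injective (∉-class⇒ u∉) (∉-class⇒ v∉)
    minimal : ∀ m → Colourable G (class i) m → k ≤ m
    minimal m (c , c-proper) = ≤-pred (proj₂ χ≡suc-k (suc m) (c′ , c′-proper))
      where
      c′ : ∀ v → v ∉ emptySet → Fin (suc m)
      c′ v _ with v ∈? class i
      ... | yes _   = zero
      ... | no  v∉ = suc (c v v∉)
      c′-proper : ∀ u v u∉ v∉ → Adj G u v → c′ u u∉ ≢ c′ v v∉
      c′-proper u v _ _ u~v with u ∈? class i | v ∈? class i
      ... | yes u∈ | yes v∈ = λ _ → class-independent i u v u∈ v∈ u~v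
      ... | yes _  | no  _  = λ ()
      ... | no  _  | yes _  = λ ()
      ... | no  u∉ | no  v∉ = c-proper u v u∉ v∉ u~v ∘ sucᶠ-injective

  ∑∣class∣≡n : sum (λ i → ∣ class i ∣) ≡ n
  ∑∣class∣≡n = begin
    sum (λ i → ∣ class i ∣)
      ≡⟨ sum-cong-≗ (λ i → ∣tabulate∣≡count (λ v → does (colour v ≟ᶠ i))) ⟩
    sum (λ i → sum (λ v → 𝟙 (does (colour v ≟ᶠ i))))
      ≡⟨ ∑-comm (λ i v → 𝟙 (does (colour v ≟ᶠ i))) ⟩
    sum (λ v → sum (λ i → 𝟙 (does (colour v ≟ᶠ i))))
      ≡⟨ sum-cong-≗ (λ v → sum-indicator (colour v)) ⟩
    sum {n} (λ _ → 1)
      ≡⟨ sum-const n 1 ⟩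
    n * 1
      ≡⟨ *-identityʳ n ⟩
    n ∎
    where open ≡-Reasoning

χ*ivs≤n : ∀ {n} (G : Graph n) {χ ivs} → IsChi G χ → IsIvs G ivs → χ * ivs ≤ n
χ*ivs≤n G {zero}        _        _         = z≤n
χ*ivs≤n {n} G {suc k} {ivs} χ≡suc-k (_ , ivs-min) = begin
  suc k * ivs              ≡⟨ sum-const (suc k) ivs ⟨
  sum {suc k} (λ _ → ivs) ≤⟨ sum-mono-≤ (λ i →
                               ivs-min _ (class i , class-independent i , class-reducing i , refl)) ⟩
  sum (λ i → ∣ class i ∣)  ≡⟨ ∑∣class∣≡n ⟩
  n                        ∎
  where
  open ≤-Reasoning
  open ColourClasses G χ≡suc-k

m*n≤9⇒m≡3×n≡3 : ∀ {m n} → 3 ≤ m → 3 ≤ n → m * n ≤ 9 → m ≡ 3 × n ≡ 3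
m*n≤9⇒m≡3×n≡3 {m} {n} 3≤m 3≤n m*n≤9 =
  ≤-antisym (*-cancelʳ-≤ m 3 3 (≤-trans (*-monoʳ-≤ m 3≤n) m*n≤9)) 3≤m ,
  ≤-antisym (*-cancelˡ-≤ 3 (≤-trans (*-monoˡ-≤ n 3≤m) m*n≤9)) 3≤n

lemma6 : ∀ (n : ℕ) (G : Graph n) (χ vs ivs : ℕ) →
    IsChi G χ → IsVs G vs → IsIvs G ivs →
    vs < ivs → Δ G + 2 ≤ 2 * χ →
    (9 ≤ n × 3 ≤ ivs × 2 ≤ vs × 3 ≤ χ) ×
    (n ≡ 9 → ivs ≡ 3 × vs ≡ 2 × χ ≡ 3)
lemma6 n G χ vs ivs χ-min ((S , S-reducing , ∣S∣≡vs) , _) ivs-min vs<ivs Δ+2≤2χ =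
  (9≤n , 3≤ivs , 2≤vs , 3≤χ) , λ { refl →
    let χ≡3 , ivs≡3 = m*n≤9⇒m≡3×n≡3 3≤χ 3≤ivs (χ*ivs≤n G χ-min ivs-min)
    in ivs≡3 , ≤-antisym (≤-pred (subst (vs <_) ivs≡3 vs<ivs)) 2≤vs , χ≡3 }
  where
  vs<independent : ∀ {S′} → Independent G S′ → Reducing G S′ → vs < ∣ S′ ∣
  vs<independent S′-independent S′-reducing =
    <-≤-trans vs<ivs (proj₂ ivs-min _ (_ , S′-independent , S′-reducing , refl))

  2≤vs : 2 ≤ vs
  2≤vs = ≮⇒≥ λ vs<2 → <-irrefl (sym ∣S∣≡vs)
    (vs<independent (∣∣≤1⇒independent G (subst (_≤ 1) (sym ∣S∣≡vs) (≤-pred vs<2))) S-reducing)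

  3≤χ : 3 ≤ χ
  3≤χ = ≮⇒≥ λ χ<3 →
    let S′ , S′-independent , S′-reducing , ∣S′∣≤∣S∣ =
          χ≤2⇒independent-reducing G χ-min (≤-pred χ<3) Δ+2≤2χ S-reducing
    in <⇒≱ (vs<independent S′-independent S′-reducing) (≤-trans ∣S′∣≤∣S∣ (≤-reflexive ∣S∣≡vs))

  3≤ivs : 3 ≤ ivs
  3≤ivs = ≤-trans (s≤s 2≤vs) vs<ivs

  9≤n : 9 ≤ n
  9≤n = ≤-trans (*-mono-≤ 3≤χ 3≤ivs) (χ*ivs≤n G χ-min ivs-min)
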